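{- Let $q$ be a power of an odd prime and suppose $\tau\in\mathbb{F}_q$ is such that $\tau$ and $1+\tau$ are both nonzero squares. Then (i) $1/\tau$ and $1+1/\tau$ are both nonzero squares; (ii) for a square root $\sqrt{1+\tau}\in\mathbb{F}_q$, the elements $1+1/\sqrt{1+\tau}$ and $1-1/\sqrt{1+\tau}$ are both squares or both nonsquares, so $\left(\frac{1\pm1/\sqrt{1+\tau}}{q}\right)$ is well defined; similarly $\left(\frac{1\pm1/\sqrt{1+1/\tau}}{q}\right)$ is well defined; (iii) $\left(\frac{1\pm1/\sqrt{1+1/\tau}}{q}\right)=\left(\frac{2}{q}\right)\left(\frac{1\pm1/\sqrt{1+\tau}}{q}\right)$.
   Context: $\mathbb{F}_q$ is the field with $q$ elements. For $x\in\mathbb{F}_q$, $\left(\frac{x}{q}\right)$ is the Legendre symbol ($1$ on nonzero squares, $-1$ on nonsquares, $0$ at $0$). -}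

module Defs where

open import Level using (Level; _⊔_) renaming (suc to lsuc)
open import Algebra.Bundles using (CommutativeRing)
open import Data.Nat using (ℕ)
open import Data.Fin using (Fin)
open import Data.Fin.Properties using (any?)
open import Data.Integer using (ℤ; +_; -[1+_])
open import Data.Product using (Σ; ∃; _,_)
import Data.Product
import Data.Sum
open import Relation.Nullary using (¬_; Dec; yes; no)
open import Relation.Nullary.Decidable using (map′)
open import Relation.Binary.PropositionalEquality using (_≡_)
open import Relation.Binary using (Decidable)

-- A finite field: a commutative ring (stdlib bundle) with 0 ≠ 1,
-- a multiplicative inverse for every nonzero element (total operation,
-- value at 0 irrelevant), decidable equality, and a bijective
-- enumeration by Fin size (so the carrier has exactly `size` elements).
record FiniteField (c ℓ : Level) : Set (lsuc (c ⊔ ℓ)) where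
  field
    commRing : CommutativeRing c ℓ
  open CommutativeRing commRing public
  field
    _⁻¹       : Carrier → Carrier
    ⁻¹-inverse : ∀ x → ¬ (x ≈ 0#) → x * (x ⁻¹) ≈ 1#
    0≉1       : ¬ (0# ≈ 1#)
    _≟_       : Decidable _≈_
    size      : ℕ
    enum      : Fin size → Carrier
    enum-surj : ∀ x → ∃ λ i → enum i ≈ x
    enum-inj  : ∀ i j → enum i ≈ enum j → i ≡ j

  2# : Carrier
  2# = 1# + 1#

  IsSquare : Carrier → Set (c ⊔ ℓ)
  IsSquare x = ∃ λ y → y * y ≈ x

  IsNonzeroSquare : Carrier → Set (c ⊔ ℓ)
  IsNonzeroSquare x = ¬ (x ≈ 0#) Data.Product.× IsSquare x

  isSquare? : ∀ x → Dec (IsSquare x)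
  isSquare? x =
    map′ (λ { (i , e) → enum i , e })
         (λ { (y , e) → Σ.proj₁ (enum-surj y) , trans (*-cong (Σ.proj₂ (enum-surj y)) (Σ.proj₂ (enum-surj y))) e })
         (any? (λ i → (enum i * enum i) ≟ x))

  legendre : Carrier → ℤ
  legendre x with x ≟ 0#
  ... | yes _ = + 0
  ... | no _ with isSquare? x
  ... | yes _ = + 1
  ... | no _ = -[1+ 0 ]

  SameSquareClass : Carrier → Carrier → Set (c ⊔ ℓ)
  SameSquareClass x y =
    (IsSquare x Data.Product.× IsSquare y) Data.Sum.⊎ (¬ IsSquare x Data.Product.× ¬ IsSquare y)

-- Put σ = 1/s and u = 1/t.  Since σ² = 1/(1+τ) and u² = 1/(1+1/τ) = τ/(1+τ), the point (σ, u)
-- lies on the unit circle σ² + u² = 1.  On the circle (1+σ)(1-σ) = u² is a nonzero square, which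
-- gives (ii), and so is 2(1+σ)(1+u) = (1+σ+u)², which by multiplicativity of the Legendre symbol
-- gives ((1+u)/q) = (2/q)((1+σ)/q); the point (-σ, -u) gives the minus sign in (iii).
-- Multiplicativity rests on a product of two nonsquares being a square, a counting argument that
-- needs 2 ≠ 0.
module Submission where

open import Defs
open import Level using (Level)
open import Data.Nat as ℕ using (ℕ; zero; suc; _^_; _≤_; _<?_)
import Data.Nat.Properties as ℕ
open import Data.Nat.Divisibility using (_∣_; divides; ∣1⇒≡1)
open import Data.Nat.Primality using (Prime; euclidsLemma; prime[2])
open import Data.Fin using (Fin; toℕ; punchOut; _<_)
import Data.Fin.Properties as Fin
open import Data.Fin.Permutation using (Permutation; permutation)
open import Data.Integer as ℤ using () renaming (_*_ to _ℤ*_)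
import Data.Integer.Properties as ℤ
open import Data.Product using (∃; _,_; _×_; proj₁; proj₂)
open import Data.Sum using (_⊎_; inj₁; inj₂)
open import Function.Definitions using (Injective)
open import Relation.Nullary using (¬_; Dec; yes; no; contradiction)
open import Relation.Binary using (tri<; tri≈; tri>)
open import Relation.Binary.PropositionalEquality using (_≡_; _≢_)
import Relation.Binary.PropositionalEquality as ≡
open import Algebra.Properties.CommutativeMonoid.Sum ℕ.+-0-commutativeMonoid
  using (sum; sum-permute; ∑-distrib-+; sum-cong-≗)
import Algebra.Solver.Ring.NaturalCoefficients.Default as SemiringSolver

odd^ : ∀ {p} k → ¬ 2 ∣ p → ¬ 2 ∣ p ^ k
odd^ zero    _     2∣1 with () ← ∣1⇒≡1 2∣1
odd^ (suc k) p-odd 2∣pᵏ⁺¹ with euclidsLemma _ _ prime[2] 2∣pᵏ⁺¹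
... | inj₁ 2∣p  = p-odd 2∣p
... | inj₂ 2∣pᵏ = odd^ k p-odd 2∣pᵏ

[_<_] : ℕ → ℕ → ℕ
[ m < n ] with m <? n
... | yes _ = 1
... | no  _ = 0

[<]+[>]≡1 : ∀ {m n} → m ≢ n → [ m < n ] ℕ.+ [ n < m ] ≡ 1
[<]+[>]≡1 {m} {n} m≢n with m <? n | n <? m
... | yes m<n | yes n<m = contradiction n<m (ℕ.<-asym m<n)
... | yes _   | no  _   = ≡.refl
... | no  _   | yes _   = ≡.refl
... | no  m≮n | no  n≮m = contradiction (ℕ.≤-antisym (ℕ.≮⇒≥ n≮m) (ℕ.≮⇒≥ m≮n)) m≢n

sum-ones : ∀ n → sum {n} (λ _ → 1) ≡ n
sum-ones zero    = ≡.refl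
sum-ones (suc n) = ≡.cong suc (sum-ones n)

-- Each orbit {i, f i} contributes exactly one index i with i < f i.
fixedPointFree-involution⇒even : ∀ {n} (f : Fin n → Fin n) →
  (∀ i → f (f i) ≡ i) → (∀ i → f i ≢ i) → 2 ∣ n
fixedPointFree-involution⇒even {n} f involutive fixedPointFree =
  divides half (begin
    n              ≡⟨ n≡half+half ⟩
    half ℕ.+ half  ≡⟨ ≡.cong (half ℕ.+_) (≡.sym (ℕ.+-identityʳ half)) ⟩
    2 ℕ.* half     ≡⟨ ℕ.*-comm 2 half ⟩
    half ℕ.* 2     ∎)
  where
  open ≡.≡-Reasoning
  ascent : Fin n → ℕ
  ascent i = [ toℕ i < toℕ (f i) ]
  half : ℕ
  half = sum ascent
  f-perm : Permutation n n
  f-perm = permutation f f involutive involutive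
  orbit : ∀ i → 1 ≡ ascent i ℕ.+ ascent (f i)
  orbit i rewrite involutive i =
    ≡.sym ([<]+[>]≡1 λ eq → fixedPointFree i (≡.sym (Fin.toℕ-injective eq)))
  n≡half+half : n ≡ half ℕ.+ half
  n≡half+half = begin
    n                                     ≡⟨ ≡.sym (sum-ones n) ⟩
    sum {n} (λ _ → 1)                     ≡⟨ sum-cong-≗ orbit ⟩
    sum (λ i → ascent i ℕ.+ ascent (f i)) ≡⟨ ∑-distrib-+ ascent (λ i → ascent (f i)) ⟩
    half ℕ.+ sum (λ i → ascent (f i))     ≡⟨ ≡.cong (half ℕ.+_) (≡.sym (sum-permute ascent f-perm)) ⟩
    half ℕ.+ half                         ∎

injective⇒surjective : ∀ {n} {f : Fin n → Fin n} → Injective _≡_ _≡_ f →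
  ∀ j → ∃ λ i → f i ≡ j
injective⇒surjective {zero}  _ ()
injective⇒surjective {suc m} {f} f-inj j with Fin.any? (λ i → f i Fin.≟ j)
... | yes hit = hit
... | no  miss = contradiction (Fin.injective⇒≤ punchOut∘f-inj) ℕ.1+n≰n
  where
  f≢j : ∀ i → j ≢ f i
  f≢j i j≡fi = miss (i , ≡.sym j≡fi)
  punchOut∘f-inj : Injective _≡_ _≡_ (λ i → punchOut (f≢j i))
  punchOut∘f-inj eq = f-inj (Fin.punchOut-injective (f≢j _) (f≢j _) eq)

module FiniteFieldProperties {c ℓ : Level} (F : FiniteField c ℓ) where
  open FiniteField F
  open import Relation.Binary.Reasoning.Setoid setoid
  open import Algebra.Properties.Ring ring using (-0#≈0#; -‿involutive; -‿distribˡ-*; -‿distribʳ-*)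
  open import Algebra.Properties.AbelianGroup +-abelianGroup
    using (xyx⁻¹≈y; ∙-cancelˡ; ∙-cancelʳ; x∙y⁻¹≈ε⇒x≈y; inverseˡ-unique)
  open SemiringSolver commutativeSemiring using (solve; _:=_; _:+_; _:*_; con)

  NonZero : Carrier → Set ℓ
  NonZero x = ¬ x ≈ 0#

  1≉0 : NonZero 1#
  1≉0 1≈0 = 0≉1 (sym 1≈0)

  -x*-x≈x*x : ∀ x → - x * - x ≈ x * x
  -x*-x≈x*x x = begin
    - x * - x     ≈⟨ -‿distribˡ-* x (- x) ⟨
    - (x * - x)   ≈⟨ -‿cong (-‿distribʳ-* x x) ⟨
    - - (x * x)   ≈⟨ -‿involutive (x * x) ⟩
    x * x         ∎

  difference-of-squares : ∀ x y → (x + y) * (x - y) ≈ x * x - y * y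
  difference-of-squares x y = begin
    (x + y) * (x - y)               ≈⟨ solve 3 (λ x y n → (x :+ y) :* (x :+ n) := x :* x :+ (x :* (y :+ n) :+ y :* n)) refl x y (- y) ⟩
    x * x + (x * (y - y) + y * - y) ≈⟨ +-congˡ (+-congʳ (trans (*-congˡ (-‿inverseʳ y)) (zeroʳ x))) ⟩
    x * x + (0# + y * - y)          ≈⟨ +-congˡ (trans (+-identityˡ _) (sym (-‿distribʳ-* y y))) ⟩
    x * x - y * y                   ∎

  ⁻¹-inverseˡ : ∀ {x} → NonZero x → x ⁻¹ * x ≈ 1#
  ⁻¹-inverseˡ {x} x≉0 = trans (*-comm (x ⁻¹) x) (⁻¹-inverse x x≉0)

  *-cancelˡ : ∀ {x y z} → NonZero x → x * y ≈ x * z → y ≈ z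
  *-cancelˡ {x} {y} {z} x≉0 xy≈xz = begin
    y                  ≈⟨ *-identityˡ y ⟨
    1# * y             ≈⟨ *-congʳ (⁻¹-inverseˡ x≉0) ⟨
    x ⁻¹ * x * y       ≈⟨ *-assoc (x ⁻¹) x y ⟩
    x ⁻¹ * (x * y)     ≈⟨ *-congˡ xy≈xz ⟩
    x ⁻¹ * (x * z)     ≈⟨ *-assoc (x ⁻¹) x z ⟨
    x ⁻¹ * x * z       ≈⟨ *-congʳ (⁻¹-inverseˡ x≉0) ⟩
    1# * z             ≈⟨ *-identityˡ z ⟩
    z                  ∎

  x*y≈0⇒x≈0⊎y≈0 : ∀ {x y} → x * y ≈ 0# → x ≈ 0# ⊎ y ≈ 0#
  x*y≈0⇒x≈0⊎y≈0 {x} {y} xy≈0 with x ≟ 0#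
  ... | yes x≈0 = inj₁ x≈0
  ... | no  x≉0 = inj₂ (*-cancelˡ x≉0 (trans xy≈0 (sym (zeroʳ x))))

  *-nonzero : ∀ {x y} → NonZero x → NonZero y → NonZero (x * y)
  *-nonzero x≉0 y≉0 xy≈0 with x*y≈0⇒x≈0⊎y≈0 xy≈0
  ... | inj₁ x≈0 = x≉0 x≈0
  ... | inj₂ y≈0 = y≉0 y≈0

  nonzero-*ˡ : ∀ {x y} → NonZero (x * y) → NonZero x
  nonzero-*ˡ {x} {y} xy≉0 x≈0 = xy≉0 (trans (*-congʳ x≈0) (zeroˡ y))

  nonzero-*ʳ : ∀ {x y} → NonZero (x * y) → NonZero y
  nonzero-*ʳ {x} {y} xy≉0 y≈0 = xy≉0 (trans (*-congˡ y≈0) (zeroʳ x))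

  root-nonzero : ∀ {u x} → u * u ≈ x → NonZero x → NonZero u
  root-nonzero u²≈x x≉0 = nonzero-*ˡ (λ u²≈0 → x≉0 (trans (sym u²≈x) u²≈0))

  -‿nonzero : ∀ {x} → NonZero x → NonZero (- x)
  -‿nonzero {x} x≉0 -x≈0 = x≉0 (trans (sym (-‿involutive x)) (trans (-‿cong -x≈0) -0#≈0#))

  ⁻¹-nonzero : ∀ {x} → NonZero x → NonZero (x ⁻¹)
  ⁻¹-nonzero {x} x≉0 = nonzero-*ʳ (λ xx⁻¹≈0 → 1≉0 (trans (sym (⁻¹-inverse x x≉0)) xx⁻¹≈0))

  inverse-unique : ∀ {x y} → x * y ≈ 1# → y ≈ x ⁻¹
  inverse-unique {x} {y} xy≈1 =
    *-cancelˡ x≉0 (trans xy≈1 (sym (⁻¹-inverse x x≉0)))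
    where
    x≉0 : NonZero x
    x≉0 = nonzero-*ˡ (λ xy≈0 → 1≉0 (trans (sym xy≈1) xy≈0))

  ⁻¹-square-inverse : ∀ {u x} → u * u ≈ x → NonZero x → (u ⁻¹ * u ⁻¹) * x ≈ 1#
  ⁻¹-square-inverse {u} {x} u²≈x x≉0 = begin
    (u ⁻¹ * u ⁻¹) * x          ≈⟨ *-congˡ u²≈x ⟨
    (u ⁻¹ * u ⁻¹) * (u * u)    ≈⟨ solve 2 (λ u v → (v :* v) :* (u :* u) := (v :* u) :* (v :* u)) refl u (u ⁻¹) ⟩
    (u ⁻¹ * u) * (u ⁻¹ * u)    ≈⟨ *-cong (⁻¹-inverseˡ u≉0) (⁻¹-inverseˡ u≉0) ⟩
    1# * 1#                    ≈⟨ *-identityˡ 1# ⟩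
    1#                         ∎
    where
    u≉0 : NonZero u
    u≉0 = root-nonzero u²≈x x≉0

  ⁻¹-square : ∀ {u x} → u * u ≈ x → NonZero x → u ⁻¹ * u ⁻¹ ≈ x ⁻¹
  ⁻¹-square u²≈x x≉0 = inverse-unique (trans (*-comm _ _) (⁻¹-square-inverse u²≈x x≉0))

  square-roots : ∀ {x y} → x * x ≈ y * y → x ≈ y ⊎ x ≈ - y
  square-roots {x} {y} x²≈y² with x*y≈0⇒x≈0⊎y≈0 (begin
    (x + y) * (x - y) ≈⟨ difference-of-squares x y ⟩
    x * x - y * y     ≈⟨ +-congʳ x²≈y² ⟩
    y * y - y * y     ≈⟨ -‿inverseʳ (y * y) ⟩
    0#                ∎)
  ... | inj₁ x+y≈0 = inj₂ (inverseˡ-unique x y x+y≈0)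
  ... | inj₂ x-y≈0 = inj₁ (x∙y⁻¹≈ε⇒x≈y x y x-y≈0)

  x*x≈0⇒x≈0 : ∀ {x} → x * x ≈ 0# → x ≈ 0#
  x*x≈0⇒x≈0 x²≈0 with x*y≈0⇒x≈0⊎y≈0 x²≈0
  ... | inj₁ x≈0 = x≈0
  ... | inj₂ x≈0 = x≈0

  square-cong : ∀ {x y} → x ≈ y → IsSquare x → IsSquare y
  square-cong x≈y (u , u²≈x) = u , trans u²≈x x≈y

  square-* : ∀ {x y} → IsSquare x → IsSquare y → IsSquare (x * y)
  square-* {x} {y} (u , u²≈x) (v , v²≈y) = u * v , (begin
    (u * v) * (u * v) ≈⟨ solve 2 (λ u v → (u :* v) :* (u :* v) := (u :* u) :* (v :* v)) refl u v ⟩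
    (u * u) * (v * v) ≈⟨ *-cong u²≈x v²≈y ⟩
    x * y             ∎)

  square-cancelˡ : ∀ {x y} → NonZero x → IsSquare x → IsSquare (x * y) → IsSquare y
  square-cancelˡ {x} {y} x≉0 (u , u²≈x) □xy = square-cong x⁻¹xy≈y (square-* (u ⁻¹ , ⁻¹-square u²≈x x≉0) □xy)
    where
    x⁻¹xy≈y : x ⁻¹ * (x * y) ≈ y
    x⁻¹xy≈y = trans (sym (*-assoc _ _ _)) (trans (*-congʳ (⁻¹-inverseˡ x≉0)) (*-identityˡ y))

  nonzeroSquare-cong : ∀ {x y} → x ≈ y → IsNonzeroSquare x → IsNonzeroSquare y
  nonzeroSquare-cong x≈y (x≉0 , □x) = (λ y≈0 → x≉0 (trans x≈y y≈0)) , square-cong x≈y □x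

  nonzeroSquare-* : ∀ {x y} → IsNonzeroSquare x → IsNonzeroSquare y → IsNonzeroSquare (x * y)
  nonzeroSquare-* (x≉0 , □x) (y≉0 , □y) = *-nonzero x≉0 y≉0 , square-* □x □y

  sameSquareClass-of-nonzeroSquare-product : ∀ {x y} → IsNonzeroSquare (x * y) → SameSquareClass x y
  sameSquareClass-of-nonzeroSquare-product {x} {y} (xy≉0 , □xy) with isSquare? x
  ... | yes □x = inj₁ (□x , square-cancelˡ (nonzero-*ˡ xy≉0) □x □xy)
  ... | no ¬□x = inj₂ (¬□x , λ □y → ¬□x (square-cancelˡ (nonzero-*ʳ xy≉0) □y (square-cong (*-comm x y) □xy)))

  legendre-zero : ∀ {x} → x ≈ 0# → legendre x ≡ ℤ.+ 0
  legendre-zero {x} x≈0 with x ≟ 0#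
  ... | yes _   = ≡.refl
  ... | no  x≉0 = contradiction x≈0 x≉0

  legendre-square : ∀ {x} → NonZero x → IsSquare x → legendre x ≡ ℤ.+ 1
  legendre-square {x} x≉0 □x with x ≟ 0#
  ... | yes x≈0 = contradiction x≈0 x≉0
  ... | no  _ with isSquare? x
  ... | yes _   = ≡.refl
  ... | no  ¬□x = contradiction □x ¬□x

  legendre-nonsquare : ∀ {x} → ¬ IsSquare x → legendre x ≡ ℤ.-[1+ 0 ]
  legendre-nonsquare {x} ¬□x with x ≟ 0#
  ... | yes x≈0 = contradiction (0# , trans (zeroˡ 0#) (sym x≈0)) ¬□x
  ... | no  _ with isSquare? x
  ... | yes □x  = contradiction □x ¬□x
  ... | no  _   = ≡.refl

  legendre-sameSquareClass : ∀ {x y} → NonZero x → NonZero y → SameSquareClass x y → legendre x ≡ legendre y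
  legendre-sameSquareClass x≉0 y≉0 (inj₁ (□x , □y)) =
    ≡.trans (legendre-square x≉0 □x) (≡.sym (legendre-square y≉0 □y))
  legendre-sameSquareClass _ _ (inj₂ (¬□x , ¬□y)) =
    ≡.trans (legendre-nonsquare ¬□x) (≡.sym (legendre-nonsquare ¬□y))

  OnUnitCircle : Carrier → Carrier → Set ℓ
  OnUnitCircle σ w = σ * σ + w * w ≈ 1#

  onUnitCircle-swap : ∀ {σ w} → OnUnitCircle σ w → OnUnitCircle w σ
  onUnitCircle-swap {σ} {w} σ²+w²≈1 = trans (+-comm (w * w) (σ * σ)) σ²+w²≈1

  onUnitCircle-neg : ∀ {σ w} → OnUnitCircle σ w → OnUnitCircle (- σ) (- w)
  onUnitCircle-neg {σ} {w} = trans (+-cong (-x*-x≈x*x σ) (-x*-x≈x*x w))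

  onUnitCircle-scale : ∀ {r x} → r * r * (1# + x * x) ≈ 1# → OnUnitCircle r (r * x)
  onUnitCircle-scale {r} {x} = trans (solve 2 (λ r x → r :* r :+ (r :* x) :* (r :* x) := r :* r :* (con 1 :+ x :* x)) refl r x)

  onUnitCircle-1-σ² : ∀ {σ w} → OnUnitCircle σ w → (1# + σ) * (1# - σ) ≈ w * w
  onUnitCircle-1-σ² {σ} {w} σ²+w²≈1 = begin
    (1# + σ) * (1# - σ)      ≈⟨ difference-of-squares 1# σ ⟩
    1# * 1# - σ * σ          ≈⟨ +-congʳ (trans (*-identityˡ 1#) (sym σ²+w²≈1)) ⟩
    σ * σ + w * w - σ * σ    ≈⟨ xyx⁻¹≈y (σ * σ) (w * w) ⟩
    w * w                    ∎

  onUnitCircle-1-σ²-nonzeroSquare : ∀ {σ w} → OnUnitCircle σ w → NonZero w → IsNonzeroSquare ((1# + σ) * (1# - σ))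
  onUnitCircle-1-σ²-nonzeroSquare σ²+w²≈1 w≉0 =
    nonzeroSquare-cong (sym (onUnitCircle-1-σ² σ²+w²≈1)) (*-nonzero w≉0 w≉0 , (_ , refl))

  onUnitCircle-1+σ≉0 : ∀ {σ w} → OnUnitCircle σ w → NonZero w → NonZero (1# + σ)
  onUnitCircle-1+σ≉0 σ²+w²≈1 w≉0 = nonzero-*ˡ (proj₁ (onUnitCircle-1-σ²-nonzeroSquare σ²+w²≈1 w≉0))

  onUnitCircle-halfAngle : ∀ {σ w} → OnUnitCircle σ w → (1# + w) * (2# * (1# + σ)) ≈ (1# + σ + w) * (1# + σ + w)
  onUnitCircle-halfAngle {σ} {w} σ²+w²≈1 = ∙-cancelʳ 1# _ _ (begin
    (1# + w) * (2# * (1# + σ)) + 1#                ≈⟨ +-congˡ σ²+w²≈1 ⟨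
    (1# + w) * (2# * (1# + σ)) + (σ * σ + w * w)   ≈⟨ solve 2 (λ σ w → (con 1 :+ w) :* ((con 1 :+ con 1) :* (con 1 :+ σ)) :+ (σ :* σ :+ w :* w)
                                                                  := (con 1 :+ σ :+ w) :* (con 1 :+ σ :+ w) :+ con 1) refl σ w ⟩
    (1# + σ + w) * (1# + σ + w) + 1#               ∎)

  onUnitCircle-sameSquareClass : ∀ {σ w} → OnUnitCircle σ w → NonZero w →
    SameSquareClass (1# + σ) (1# - σ) × legendre (1# + σ) ≡ legendre (1# - σ)
  onUnitCircle-sameSquareClass {σ} σ²+w²≈1 w≉0 =
    same , legendre-sameSquareClass (nonzero-*ˡ 1-σ²≉0) (nonzero-*ʳ 1-σ²≉0) same
    where
    □1-σ² : IsNonzeroSquare ((1# + σ) * (1# - σ))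
    □1-σ² = onUnitCircle-1-σ²-nonzeroSquare σ²+w²≈1 w≉0
    1-σ²≉0 : NonZero ((1# + σ) * (1# - σ))
    1-σ²≉0 = proj₁ □1-σ²
    same : SameSquareClass (1# + σ) (1# - σ)
    same = sameSquareClass-of-nonzeroSquare-product □1-σ²

  [1+x]⁻¹+[1+x⁻¹]⁻¹≈1 : ∀ {x a b} → NonZero x → a * (1# + x) ≈ 1# → b * (1# + x ⁻¹) ≈ 1# → a + b ≈ 1#
  [1+x]⁻¹+[1+x⁻¹]⁻¹≈1 {x} {a} {b} x≉0 a[1+x]≈1 b[1+x⁻¹]≈1 = begin
    a + b                        ≈⟨ +-congˡ b≈ax ⟩
    a + a * x                    ≈⟨ solve 2 (λ a x → a :+ a :* x := a :* (con 1 :+ x)) refl a x ⟩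
    a * (1# + x)                 ≈⟨ a[1+x]≈1 ⟩
    1#                           ∎
    where
    b≈ax : b ≈ a * x
    b≈ax = begin
      b                          ≈⟨ *-identityʳ b ⟨
      b * 1#                     ≈⟨ *-congˡ a[1+x]≈1 ⟨
      b * (a * (1# + x))         ≈⟨ solve 3 (λ a b x → b :* (a :* (con 1 :+ x)) := a :* (b :* (con 1 :+ x))) refl a b x ⟩
      a * (b * (1# + x))         ≈⟨ *-congˡ (*-congˡ (+-congʳ (⁻¹-inverse x x≉0))) ⟨
      a * (b * (x * x ⁻¹ + x))   ≈⟨ *-congˡ (solve 3 (λ b x y → b :* (x :* y :+ x) := x :* (b :* (con 1 :+ y))) refl b x (x ⁻¹)) ⟩
      a * (x * (b * (1# + x ⁻¹))) ≈⟨ *-congˡ (trans (*-congˡ b[1+x⁻¹]≈1) (*-identityʳ x)) ⟩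
      a * x                      ∎

  index : Carrier → Fin size
  index x = proj₁ (enum-surj x)

  enum-index : ∀ x → enum (index x) ≈ x
  enum-index x = proj₂ (enum-surj x)

  index-cong : ∀ {x y} → x ≈ y → index x ≡ index y
  index-cong {x} {y} x≈y = enum-inj _ _ (trans (enum-index x) (trans x≈y (sym (enum-index y))))

  index-injective : ∀ {x y} → index x ≡ index y → x ≈ y
  index-injective {x} {y} eq = trans (sym (enum-index x)) (trans (reflexive (≡.cong enum eq)) (enum-index y))

  -- If 2 = 0 then x ↦ x + 1 is a fixed-point-free involution.
  odd-size⇒2≉0 : ¬ 2 ∣ size → NonZero 2#
  odd-size⇒2≉0 size-odd 2≈0 = size-odd (fixedPointFree-involution⇒even shift shift-involutive shift-fixedPointFree)
    where
    shift : Fin size → Fin size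
    shift i = index (enum i + 1#)
    enum-shift : ∀ i → enum (shift i) ≈ enum i + 1#
    enum-shift i = enum-index (enum i + 1#)
    shift-involutive : ∀ i → shift (shift i) ≡ i
    shift-involutive i = enum-inj _ _ (begin
      enum (shift (shift i))  ≈⟨ enum-shift (shift i) ⟩
      enum (shift i) + 1#     ≈⟨ +-congʳ (enum-shift i) ⟩
      enum i + 1# + 1#        ≈⟨ +-assoc (enum i) 1# 1# ⟩
      enum i + 2#             ≈⟨ +-congˡ 2≈0 ⟩
      enum i + 0#             ≈⟨ +-identityʳ (enum i) ⟩
      enum i                  ∎)
    shift-fixedPointFree : ∀ i → shift i ≢ i
    shift-fixedPointFree i shift-i≡i = 1≉0 (∙-cancelˡ (enum i) 1# 0# (begin
      enum i + 1#     ≈⟨ enum-shift i ⟨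
      enum (shift i)  ≈⟨ reflexive (≡.cong enum shift-i≡i) ⟩
      enum i          ≈⟨ +-identityʳ (enum i) ⟨
      enum i + 0#     ∎))

  reciprocal-nonzeroSquares : ∀ {τ} → IsNonzeroSquare τ → IsNonzeroSquare (1# + τ) →
    IsNonzeroSquare (τ ⁻¹) × IsNonzeroSquare (1# + τ ⁻¹)
  reciprocal-nonzeroSquares {τ} (τ≉0 , y , y²≈τ) □1+τ =
    □τ⁻¹ , nonzeroSquare-cong τ⁻¹[1+τ]≈1+τ⁻¹ (nonzeroSquare-* □τ⁻¹ □1+τ)
    where
    □τ⁻¹ : IsNonzeroSquare (τ ⁻¹)
    □τ⁻¹ = ⁻¹-nonzero τ≉0 , (y ⁻¹ , ⁻¹-square y²≈τ τ≉0)
    τ⁻¹[1+τ]≈1+τ⁻¹ : τ ⁻¹ * (1# + τ) ≈ 1# + τ ⁻¹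
    τ⁻¹[1+τ]≈1+τ⁻¹ = begin
      τ ⁻¹ * (1# + τ)      ≈⟨ solve 2 (λ i t → i :* (con 1 :+ t) := t :* i :+ i) refl (τ ⁻¹) τ ⟩
      τ * τ ⁻¹ + τ ⁻¹      ≈⟨ +-congʳ (⁻¹-inverse τ τ≉0) ⟩
      1# + τ ⁻¹            ∎

  root⁻¹-onUnitCircle : ∀ {ρ x s} → x * x ≈ ρ → NonZero (1# + ρ) → s * s ≈ 1# + ρ →
    OnUnitCircle (s ⁻¹) (s ⁻¹ * x)
  root⁻¹-onUnitCircle {ρ} {x} {s} x²≈ρ 1+ρ≉0 s²≈1+ρ =
    onUnitCircle-scale (trans (*-congˡ (+-congˡ x²≈ρ)) (⁻¹-square-inverse s²≈1+ρ 1+ρ≉0))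

  1±s⁻¹-sameSquareClass : ∀ {ρ x s} → x * x ≈ ρ → NonZero x → NonZero (1# + ρ) → s * s ≈ 1# + ρ →
    SameSquareClass (1# + s ⁻¹) (1# - s ⁻¹) × legendre (1# + s ⁻¹) ≡ legendre (1# - s ⁻¹)
  1±s⁻¹-sameSquareClass x²≈ρ x≉0 1+ρ≉0 s²≈1+ρ =
    onUnitCircle-sameSquareClass (root⁻¹-onUnitCircle x²≈ρ 1+ρ≉0 s²≈1+ρ)
      (*-nonzero (⁻¹-nonzero (root-nonzero s²≈1+ρ 1+ρ≉0)) x≉0)

  module _ (2≉0 : NonZero 2#) where

    -- An arbitrary choice of one element out of each pair {x, - x} with x ≉ 0.
    Positive : Carrier → Set
    Positive x = index x < index (- x)

    positive-resp : ∀ {x y} → x ≈ y → Positive x → Positive y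
    positive-resp x≈y = ≡.subst₂ _<_ (index-cong x≈y) (index-cong (-‿cong x≈y))

    positive⇒¬positive-neg : ∀ {x} → Positive x → ¬ Positive (- x)
    positive⇒¬positive-neg {x} pos pos-neg =
      Fin.<-asym pos (≡.subst (index (- x) <_) (index-cong (-‿involutive x)) pos-neg)

    positive⇒nonzero : ∀ {x} → Positive x → NonZero x
    positive⇒nonzero {x} pos x≈0 =
      positive⇒¬positive-neg pos (positive-resp (trans x≈0 (sym (trans (-‿cong x≈0) -0#≈0#))) pos)

    x≈-x⇒x≈0 : ∀ {x} → x ≈ - x → x ≈ 0#
    x≈-x⇒x≈0 {x} x≈-x with x*y≈0⇒x≈0⊎y≈0 (begin
      2# * x  ≈⟨ solve 1 (λ x → (con 1 :+ con 1) :* x := x :+ x) refl x ⟩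
      x + x   ≈⟨ +-congˡ x≈-x ⟩
      x - x   ≈⟨ -‿inverseʳ x ⟩
      0#      ∎)
    ... | inj₁ 2≈0 = contradiction 2≈0 2≉0
    ... | inj₂ x≈0 = x≈0

    nonpositive-pair⇒zero : ∀ {x} → ¬ Positive x → ¬ Positive (- x) → x ≈ 0#
    nonpositive-pair⇒zero {x} ¬pos ¬pos-neg with Fin.<-cmp (index x) (index (- x))
    ... | tri< pos _ _ = contradiction pos ¬pos
    ... | tri≈ _ eq _  = x≈-x⇒x≈0 (index-injective eq)
    ... | tri> _ _ neg = contradiction (≡.subst (index (- x) <_) (≡.sym (index-cong (-‿involutive x))) neg) ¬pos-neg

    -- x ↦ x² on positive x and x ↦ a x² elsewhere is injective, so it hits every nonsquare.
    module _ {a : Carrier} (¬□a : ¬ IsSquare a) where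

      twist : Carrier → Carrier
      twist x with index x Fin.<? index (- x)
      ... | yes _ = x * x
      ... | no  _ = a * (x * x)

      twist-cases : ∀ x → (Positive x × twist x ≈ x * x) ⊎ (¬ Positive x × twist x ≈ a * (x * x))
      twist-cases x with index x Fin.<? index (- x)
      ... | yes pos = inj₁ (pos , refl)
      ... | no ¬pos = inj₂ (¬pos , refl)

      a≉0 : NonZero a
      a≉0 a≈0 = ¬□a (0# , trans (zeroˡ 0#) (sym a≈0))

      square≉twisted : ∀ {x y} → Positive x → ¬ x * x ≈ a * (y * y)
      square≉twisted {x} {y} pos x²≈ay² with y ≟ 0#
      ... | yes y≈0 = positive⇒nonzero pos
        (x*x≈0⇒x≈0 (trans x²≈ay² (trans (*-congˡ (trans (*-congʳ y≈0) (zeroˡ y))) (zeroʳ a))))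
      ... | no  y≉0 = ¬□a (square-cancelˡ (*-nonzero y≉0 y≉0) (y , refl) (x , trans x²≈ay² (*-comm a (y * y))))

      twist-injective : ∀ {x y} → twist x ≈ twist y → x ≈ y
      twist-injective {x} {y} tx≈ty with twist-cases x | twist-cases y
      ... | inj₁ (pos-x , tx≈x²) | inj₁ (pos-y , ty≈y²) with square-roots (trans (sym tx≈x²) (trans tx≈ty ty≈y²))
      ...   | inj₁ x≈y  = x≈y
      ...   | inj₂ x≈-y = contradiction (positive-resp x≈-y pos-x) (positive⇒¬positive-neg pos-y)
      twist-injective tx≈ty | inj₁ (pos-x , tx≈x²) | inj₂ (_ , ty≈ay²) =
        contradiction (trans (sym tx≈x²) (trans tx≈ty ty≈ay²)) (square≉twisted pos-x)
      twist-injective tx≈ty | inj₂ (_ , tx≈ax²) | inj₁ (pos-y , ty≈y²) =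
        contradiction (trans (sym ty≈y²) (trans (sym tx≈ty) tx≈ax²)) (square≉twisted pos-y)
      twist-injective {x} {y} tx≈ty | inj₂ (¬pos-x , tx≈ax²) | inj₂ (¬pos-y , ty≈ay²)
        with square-roots (*-cancelˡ a≉0 (trans (sym tx≈ax²) (trans tx≈ty ty≈ay²)))
      ...   | inj₁ x≈y  = x≈y
      ...   | inj₂ x≈-y = trans x≈-y (trans (-‿cong y≈0) (trans -0#≈0# (sym y≈0)))
        where
        y≈0 : y ≈ 0#
        y≈0 = nonpositive-pair⇒zero ¬pos-y (λ pos-neg → ¬pos-x (positive-resp (sym x≈-y) pos-neg))

      nonsquare*nonsquare : ∀ {b} → ¬ IsSquare b → IsSquare (a * b)
      nonsquare*nonsquare {b} ¬□b with injective⇒surjective twist-on-indices-injective (index b)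
        where
        twist-on-indices-injective : Injective ≡._≡_ ≡._≡_ (λ i → index (twist (enum i)))
        twist-on-indices-injective eq = enum-inj _ _ (twist-injective (index-injective eq))
      ... | i , hit with twist-cases (enum i)
      ...   | inj₁ (_ , t≈x²)  = contradiction (enum i , trans (sym t≈x²) (index-injective hit)) ¬□b
      ...   | inj₂ (_ , t≈ax²) = a * enum i , (begin
        (a * enum i) * (a * enum i)  ≈⟨ solve 2 (λ a x → (a :* x) :* (a :* x) := a :* (a :* (x :* x))) refl a (enum i) ⟩
        a * (a * (enum i * enum i))  ≈⟨ *-congˡ (trans (sym t≈ax²) (index-injective hit)) ⟩
        a * b                        ∎)

    legendre-* : ∀ x y → legendre (x * y) ≡ legendre x ℤ* legendre y
    legendre-* x y = by-cases (x ≟ 0#) (y ≟ 0#) (isSquare? x) (isSquare? y)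
      where
      by-cases : Dec (x ≈ 0#) → Dec (y ≈ 0#) → Dec (IsSquare x) → Dec (IsSquare y) →
        legendre (x * y) ≡ legendre x ℤ* legendre y
      by-cases (yes x≈0) _ _ _ rewrite legendre-zero x≈0 =
        legendre-zero (trans (*-congʳ x≈0) (zeroˡ y))
      by-cases (no _) (yes y≈0) _ _ rewrite legendre-zero y≈0 | ℤ.*-zeroʳ (legendre x) =
        legendre-zero (trans (*-congˡ y≈0) (zeroʳ x))
      by-cases (no x≉0) (no y≉0) (yes □x) (yes □y) rewrite legendre-square x≉0 □x | legendre-square y≉0 □y =
        legendre-square (*-nonzero x≉0 y≉0) (square-* □x □y)
      by-cases (no x≉0) (no _) (yes □x) (no ¬□y) rewrite legendre-square x≉0 □x | legendre-nonsquare ¬□y =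
        legendre-nonsquare (λ □xy → ¬□y (square-cancelˡ x≉0 □x □xy))
      by-cases (no _) (no y≉0) (no ¬□x) (yes □y) rewrite legendre-nonsquare ¬□x | legendre-square y≉0 □y =
        legendre-nonsquare (λ □xy → ¬□x (square-cancelˡ y≉0 □y (square-cong (*-comm x y) □xy)))
      by-cases (no x≉0) (no y≉0) (no ¬□x) (no ¬□y) rewrite legendre-nonsquare ¬□x | legendre-nonsquare ¬□y =
        legendre-square (*-nonzero x≉0 y≉0) (nonsquare*nonsquare ¬□x ¬□y)

    legendre-onUnitCircle : ∀ {σ w} → OnUnitCircle σ w → NonZero σ → NonZero w →
      legendre (1# + w) ≡ legendre 2# ℤ* legendre (1# + σ)
    legendre-onUnitCircle {σ} {w} σ²+w²≈1 σ≉0 w≉0 =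
      ≡.trans (legendre-sameSquareClass 1+w≉0 2[1+σ]≉0 (sameSquareClass-of-nonzeroSquare-product □))
              (legendre-* 2# (1# + σ))
      where
      1+w≉0 : NonZero (1# + w)
      1+w≉0 = onUnitCircle-1+σ≉0 (onUnitCircle-swap σ²+w²≈1) σ≉0
      2[1+σ]≉0 : NonZero (2# * (1# + σ))
      2[1+σ]≉0 = *-nonzero 2≉0 (onUnitCircle-1+σ≉0 σ²+w²≈1 w≉0)
      □ : IsNonzeroSquare ((1# + w) * (2# * (1# + σ)))
      □ = *-nonzero 1+w≉0 2[1+σ]≉0 , (1# + σ + w , sym (onUnitCircle-halfAngle σ²+w²≈1))

    legendre-1±t⁻¹ : ∀ {τ s t} → NonZero τ → NonZero (1# + τ) → NonZero (1# + τ ⁻¹) →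
      s * s ≈ 1# + τ → t * t ≈ 1# + τ ⁻¹ →
      (legendre (1# + t ⁻¹) ≡ legendre 2# ℤ* legendre (1# + s ⁻¹))
      × (legendre (1# - t ⁻¹) ≡ legendre 2# ℤ* legendre (1# - s ⁻¹))
    legendre-1±t⁻¹ {τ} {s} {t} τ≉0 1+τ≉0 1+τ⁻¹≉0 s²≈1+τ t²≈1+τ⁻¹ =
      legendre-onUnitCircle circle σ≉0 u≉0 ,
      legendre-onUnitCircle (onUnitCircle-neg circle) (-‿nonzero σ≉0) (-‿nonzero u≉0)
      where
      σ≉0 : NonZero (s ⁻¹)
      σ≉0 = ⁻¹-nonzero (root-nonzero s²≈1+τ 1+τ≉0)
      u≉0 : NonZero (t ⁻¹)
      u≉0 = ⁻¹-nonzero (root-nonzero t²≈1+τ⁻¹ 1+τ⁻¹≉0)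
      circle : OnUnitCircle (s ⁻¹) (t ⁻¹)
      circle = [1+x]⁻¹+[1+x⁻¹]⁻¹≈1 τ≉0 (⁻¹-square-inverse s²≈1+τ 1+τ≉0) (⁻¹-square-inverse t²≈1+τ⁻¹ 1+τ⁻¹≉0)


proposition6p3 : ∀ {c ℓ : Level} (F : FiniteField c ℓ) (p k : ℕ) →
    Prime p → ¬ (2 ∣ p) → 1 ≤ k → FiniteField.size F ≡ p ^ k →
    let open FiniteField F in
    (τ : Carrier) → IsNonzeroSquare τ → IsNonzeroSquare (1# + τ) →
    (IsNonzeroSquare (τ ⁻¹) × IsNonzeroSquare (1# + τ ⁻¹))
    × ((∀ s → s * s ≈ 1# + τ →
          SameSquareClass (1# + s ⁻¹) (1# - s ⁻¹)
          × legendre (1# + s ⁻¹) ≡ legendre (1# - s ⁻¹))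
       × (∀ t → t * t ≈ 1# + τ ⁻¹ →
          SameSquareClass (1# + t ⁻¹) (1# - t ⁻¹)
          × legendre (1# + t ⁻¹) ≡ legendre (1# - t ⁻¹)))
    × (∀ s t → s * s ≈ 1# + τ → t * t ≈ 1# + τ ⁻¹ →
          (legendre (1# + t ⁻¹) ≡ legendre 2# ℤ* legendre (1# + s ⁻¹))
          × (legendre (1# - t ⁻¹) ≡ legendre 2# ℤ* legendre (1# - s ⁻¹)))
proposition6p3 F p k _ p-odd _ size≡pᵏ τ □τ@(τ≉0 , y , y²≈τ) □1+τ@(1+τ≉0 , _) =
  reciprocals , (1±s⁻¹ , 1±t⁻¹) , λ s t → legendre-1±t⁻¹ 2≉0 τ≉0 1+τ≉0 1+τ⁻¹≉0
  where
  open FiniteField F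
  open FiniteFieldProperties F
  2≉0 : NonZero 2#
  2≉0 = odd-size⇒2≉0 (λ 2∣size → odd^ k p-odd (≡.subst (2 ∣_) size≡pᵏ 2∣size))
  reciprocals : IsNonzeroSquare (τ ⁻¹) × IsNonzeroSquare (1# + τ ⁻¹)
  reciprocals = reciprocal-nonzeroSquares □τ □1+τ
  1+τ⁻¹≉0 : NonZero (1# + τ ⁻¹)
  1+τ⁻¹≉0 = proj₁ (proj₂ reciprocals)
  y≉0 : NonZero y
  y≉0 = root-nonzero y²≈τ τ≉0
  1±s⁻¹ : ∀ s → s * s ≈ 1# + τ →
    SameSquareClass (1# + s ⁻¹) (1# - s ⁻¹) × legendre (1# + s ⁻¹) ≡ legendre (1# - s ⁻¹)
  1±s⁻¹ s = 1±s⁻¹-sameSquareClass y²≈τ y≉0 1+τ≉0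
  1±t⁻¹ : ∀ t → t * t ≈ 1# + τ ⁻¹ →
    SameSquareClass (1# + t ⁻¹) (1# - t ⁻¹) × legendre (1# + t ⁻¹) ≡ legendre (1# - t ⁻¹)
  1±t⁻¹ t = 1±s⁻¹-sameSquareClass (⁻¹-square y²≈τ τ≉0) (⁻¹-nonzero y≉0) 1+τ⁻¹≉0
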